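{- For integers $k\geq 2$ and $1 \leq t \leq k-1$, we have $\pi(H_{t}^{(k)}) < \pi(H_{t+2}^{(k)})$.
   Context: A $k$-graph $H=(V,E)$ has $E\subseteq\binom{V}{k}$. $H$ is $F$-free if it contains no copy of $F$. $\mathrm{ex}(n,F)$ is the maximum number of edges of an $F$-free $k$-graph on $n$ vertices and $\pi(F)=\lim_{n\to\infty}\mathrm{ex}(n,F)/\binom{n}{k}$. For $t\leq k+1$, $H_t^{(k)}$ denotes the $k$-graph with $k+1$ vertices and $t$ edges (all such $k$-graphs are isomorphic). -}

module Defs where

open import Data.Nat using (ℕ; zero; suc; _+_; _*_; _∸_; _≤_; _<_)
open import Data.Nat.Combinatorics using (_C_)
open import Data.Fin using (Fin; toℕ) renaming (zero to fzero; suc to fsuc)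
open import Data.Fin.Subset using (Subset; ⊥; ⁅_⁆; ∁; _∪_; ∣_∣)
open import Data.Vec using ([]; _∷_)
open import Data.Bool using (if_then_else_)
open import Data.List using (List; length)
open import Data.List.Relation.Unary.All using (All)
open import Data.List.Relation.Unary.Unique.Propositional using (Unique)
open import Data.List.Membership.Propositional using (_∈_)
open import Data.Product using (Σ; ∃; ∃-syntax; _×_)
open import Function.Definitions using (Injective)
open import Relation.Binary.PropositionalEquality using (_≡_)
open import Relation.Nullary using (¬_)

record KGraph (k n : ℕ) : Set where
  field
    edges  : List (Subset n)
    unique : Unique edges
    sized  : All (λ e → ∣ e ∣ ≡ k) edges
open KGraph public

nEdges : ∀ {k n} → KGraph k n → ℕ
nEdges H = length (edges H)

img : ∀ {m n} → (Fin m → Fin n) → Subset m → Subset n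
img {zero}  φ []      = ⊥
img {suc m} φ (b ∷ s) = (if b then ⁅ φ fzero ⁆ else ⊥) ∪ img (λ i → φ (fsuc i)) s

-- The k-graph H_t^(k) on vertex set Fin (k+1) has as edges the t sets
-- Fin (k+1) ∖ {i} for toℕ i < t.
ContainsH : (k t : ℕ) → ∀ {n} → KGraph k n → Set
ContainsH k t {n} H =
  Σ (Fin (suc k) → Fin n) λ φ →
    Injective _≡_ _≡_ φ ×
    (∀ (i : Fin (suc k)) → toℕ i < t → img φ (∁ ⁅ i ⁆) ∈ edges H)

HFree : (k t : ℕ) → ∀ {n} → KGraph k n → Set
HFree k t H = ¬ ContainsH k t H

-- π(H_t^(k)) < π(H_s^(k)), with π the limit of ex(n,·)/C(n,k):
-- there is a rational gap ε = 1/(d+1) > 0 and N such that for all n ≥ N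
-- some H_s-free k-graph G on n vertices has at least
-- ε·C(n,k) more edges than every H_t-free k-graph on n vertices, i.e.
-- ex(n,H_t) + ε C(n,k) ≤ ex(n,H_s) for all n ≥ N.
πLess : (k t s : ℕ) → Set
πLess k t s =
  ∃[ d ] ∃[ N ] ∀ n → N ≤ n →
    ∃[ G ] (HFree k s {n} G ×
      (∀ (G' : KGraph k n) → HFree k t G' →
         nEdges G' * suc d + (n C k) ≤ nEdges G * suc d))

{-# OPTIONS --safe #-}
-- Let G be an extremal H_t-free k-graph on n ≥ k + 1 vertices and m = ⌊n/(k+1)⌋, and fix
-- k + 1 disjoint blocks of m vertices.  A transversal (one vertex per block, in block order)
-- is never a copy of H_t in G, so one of its first t faces is missing from G.  Averaging over
-- the m^(k+1) transversals, for some block i the "crosses" avoiding block i (k-sets meeting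
-- every other block once) include at least m^k/t non-edges of G; add all of them.  A copy of
-- H_{t+2} in the new graph has at most two new faces: with three, every two of its k + 1
-- vertices would lie in a common cross, hence in different blocks, of which only k are
-- available.  So at least t of its faces are old, and reordering its vertices gives an H_t
-- in G.  Finally C(n,k) ≤ n^k ≤ (2(k+1)m)^k ≤ t (2(k+1))^k · #(added edges).
module Submission where

import Data.Bool as Bool
open import Data.Bool using (true; false; if_then_else_)
open import Data.Empty using (⊥; ⊥-elim)
open import Data.Fin using (Fin; toℕ; fromℕ<; inject≤; punchIn; punchOut; combine; _≟_)
  renaming (zero to fzero; suc to fsuc)
import Data.Fin.Properties as Fin
open import Data.Fin.Properties
  using (all?; any?; injective⇒≤; toℕ-injective; toℕ-fromℕ<; toℕ-inject≤; inject≤-injective;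
         combine-injective; punchIn-injective; punchInᵢ≢i; punchIn-punchOut; punchOut-punchIn)
import Data.Fin.Permutation as Perm
open import Data.Fin.Permutation using (Permutation′; _⟨$⟩ʳ_; _⟨$⟩ˡ_; inverseʳ; transpose; _∘ₚ_)
open import Data.Fin.Subset as Subset using (Subset; ⁅_⁆; ∁; _∪_; ∣_∣; ⊤)
  renaming (_∈_ to _∈ₛ_; _∉_ to _∉ₛ_)
open import Data.Fin.Subset.Properties
  using (⊆-antisym; x∈p∪q⁻; x∈p∪q⁺; x∈⁅x⁆; x∈⁅y⁆⇒x≡y; x≢y⇒x∉⁅y⁆; x∉⁅y⁆⇒x≢y;
         x∈∁p⇒x∉p; x∉p⇒x∈∁p; ∉⊥; ∈⊤; ∣⊥∣≡0; ∪-identityˡ)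
open import Data.List using (List; []; _∷_; [_]; _++_; map; filter; length; allFin; cartesianProductWith)
import Data.List.Membership.DecPropositional as DecMembership
open import Data.List.Membership.Propositional using (_∈_; lose; _─_)
open import Data.List.Membership.Propositional.Properties
  using (∈-map⁺; ∈-map⁻; ∈-++⁺ˡ; ∈-++⁺ʳ; ∈-++⁻; ∈-filter⁺; ∈-filter⁻; ∈-allFin;
         ∈-cartesianProductWith⁺)
open import Data.List.Properties using (length-++; length-map; length-removeAt′; length-tabulate)
open import Data.List.Relation.Binary.Subset.Propositional using (_⊆_)
open import Data.List.Relation.Unary.All as All using (All)
import Data.List.Relation.Unary.All.Properties as Allₚ
import Data.List.Relation.Unary.AllPairs as AllPairs
import Data.List.Relation.Unary.Any as Any
open import Data.List.Relation.Unary.Any using (here; there)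
open import Data.List.Relation.Unary.Unique.Propositional using (Unique)
import Data.List.Relation.Unary.Unique.Propositional.Properties as Unique
import Data.Nat as ℕ
open import Data.Nat
  using (ℕ; zero; suc; _+_; _*_; _^_; _∸_; _≤_; _<_; _<?_; z≤n; s≤s; NonZero; >-nonZero)
open import Data.Nat.Combinatorics using (_C_; nCk+nC[k+1]≡[n+1]C[k+1])
open import Data.Nat.DivMod using (_/_; _%_; m≡m%n+[m/n]*n; m%n<n; m≥n⇒m/n>0; m/n*n≤m)
open import Data.Nat.Properties hiding (_≟_)
open import Data.List.Extrema ≤-totalOrder using (argmax; argmax-all; f[xs]≤f[argmax])
open import Algebra.Properties.CommutativeSemigroup +-commutativeSemigroup
  using () renaming (interchange to +-interchange)
open import Algebra.Properties.CommutativeSemigroup *-commutativeSemigroup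
  using () renaming (interchange to *-interchange)
open import Data.Product using (∃; ∃₂; ∃-syntax; _×_; _,_; proj₁; proj₂)
open import Data.Sum using (_⊎_; inj₁; inj₂)
import Data.Vec as Vec
open import Data.Vec using (Vec; []; _∷_; lookup; tabulate; removeAt)
open import Data.Vec.Properties
  using (∷-injective; ≡-dec; lookup∘tabulate; tabulate∘lookup; tabulate-cong; removeAt-punchOut)
open import Function using (_∘_; const)
open import Function.Bundles using (Injection)
open import Function.Definitions using (Injective)
open import Function.Properties.Inverse using (↔⇒↣)
open import Relation.Binary.PropositionalEquality
  using (_≡_; _≢_; refl; sym; trans; cong; cong₂; subst; module ≡-Reasoning)
open import Relation.Nullary using (¬_; Dec; yes; no; does)
open import Relation.Nullary.Decidable
  using (map′; ¬?; _×-dec_; _→-dec_; decidable-stable; dec-true; dec-false)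

open import Defs

private
  variable
    A B : Set

-- Finite sums and enumerations

∑ : List A → (A → ℕ) → ℕ
∑ []       f = 0
∑ (x ∷ xs) f = f x + ∑ xs f

syntax ∑ xs (λ x → e) = ∑[ x ∈ xs ] e

∑-cong : ∀ (xs : List A) {f g : A → ℕ} → (∀ x → f x ≡ g x) → ∑ xs f ≡ ∑ xs g
∑-cong []       f≗g = refl
∑-cong (x ∷ xs) f≗g = cong₂ _+_ (f≗g x) (∑-cong xs f≗g)

∑-mono-≤ : ∀ (xs : List A) {f g : A → ℕ} → (∀ x → f x ≤ g x) → ∑ xs f ≤ ∑ xs g
∑-mono-≤ []       f≤g = z≤n
∑-mono-≤ (x ∷ xs) f≤g = +-mono-≤ (f≤g x) (∑-mono-≤ xs f≤g)

∑-const : ∀ (xs : List A) c → ∑[ _ ∈ xs ] c ≡ length xs * c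
∑-const []       c = refl
∑-const (x ∷ xs) c = cong (c +_) (∑-const xs c)

∑-++ : ∀ (xs ys : List A) f → ∑ (xs ++ ys) f ≡ ∑ xs f + ∑ ys f
∑-++ []       ys f = refl
∑-++ (x ∷ xs) ys f = trans (cong (f x +_) (∑-++ xs ys f)) (sym (+-assoc (f x) _ _))

∑-map : ∀ (g : A → B) xs f → ∑ (map g xs) f ≡ ∑ xs (f ∘ g)
∑-map g []       f = refl
∑-map g (x ∷ xs) f = cong (f (g x) +_) (∑-map g xs f)

∑-+ : ∀ (xs : List A) f g → ∑[ x ∈ xs ] (f x + g x) ≡ ∑ xs f + ∑ xs g
∑-+ []       f g = refl
∑-+ (x ∷ xs) f g =
  trans (cong (f x + g x +_) (∑-+ xs f g)) (+-interchange (f x) (g x) (∑ xs f) (∑ xs g))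

∑-*ˡ : ∀ (xs : List A) c f → ∑[ x ∈ xs ] (c * f x) ≡ c * ∑ xs f
∑-*ˡ []       c f = sym (*-zeroʳ c)
∑-*ˡ (x ∷ xs) c f = trans (cong (c * f x +_) (∑-*ˡ xs c f)) (sym (*-distribˡ-+ c (f x) _))

∑-comm : ∀ (xs : List A) (ys : List B) (f : A → B → ℕ) →
         ∑[ x ∈ xs ] ∑[ y ∈ ys ] f x y ≡ ∑[ y ∈ ys ] ∑[ x ∈ xs ] f x y
∑-comm []       ys f = sym (trans (∑-const ys 0) (*-zeroʳ (length ys)))
∑-comm (x ∷ xs) ys f =
  trans (cong (∑ ys (f x) +_) (∑-comm xs ys f)) (sym (∑-+ ys (f x) (λ y → ∑[ x ∈ xs ] f x y)))

∑-cartesianProductWith : ∀ {X : Set} (h : A → B → X) xs ys f →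
  ∑ (cartesianProductWith h xs ys) f ≡ ∑[ x ∈ xs ] ∑[ y ∈ ys ] f (h x y)
∑-cartesianProductWith h []       ys f = refl
∑-cartesianProductWith h (x ∷ xs) ys f =
  trans (∑-++ (map (h x) ys) _ f) (cong₂ _+_ (∑-map (h x) ys f) (∑-cartesianProductWith h xs ys f))

∈⇒≤∑ : ∀ {xs : List A} f {x} → x ∈ xs → f x ≤ ∑ xs f
∈⇒≤∑ f (here refl) = m≤m+n _ _
∈⇒≤∑ f (there x∈)  = ≤-trans (∈⇒≤∑ f x∈) (m≤n+m _ _)

∑≤length*bound : ∀ {xs : List A} {f c} → All (λ x → f x ≤ c) xs → ∑ xs f ≤ length xs * c
∑≤length*bound All.[]            = z≤n
∑≤length*bound (fx≤c All.∷ f≤c) = +-mono-≤ fx≤c (∑≤length*bound f≤c)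

length-filter≡∑ : ∀ {P : A → Set} (P? : ∀ x → Dec (P x)) xs →
                  length (filter P? xs) ≡ ∑[ x ∈ xs ] (if does (P? x) then 1 else 0)
length-filter≡∑ P? []       = refl
length-filter≡∑ P? (x ∷ xs) with does (P? x)
... | true  = cong suc (length-filter≡∑ P? xs)
... | false = length-filter≡∑ P? xs

length-allFin : ∀ m → length (allFin m) ≡ m
length-allFin m = length-tabulate (λ i → i)

vectors : List A → ∀ r → List (Vec A r)
vectors xs zero    = [ [] ]
vectors xs (suc r) = cartesianProductWith _∷_ xs (vectors xs r)

∈-vectors : ∀ {xs : List A} → (∀ x → x ∈ xs) → ∀ {r} (v : Vec A r) → v ∈ vectors xs r
∈-vectors all∈ []      = here refl
∈-vectors all∈ (x ∷ v) = ∈-cartesianProductWith⁺ _∷_ (all∈ x) (∈-vectors all∈ v)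

vectors-unique : ∀ {xs : List A} → Unique xs → ∀ r → Unique (vectors xs r)
vectors-unique u zero    = All.[] AllPairs.∷ AllPairs.[]
vectors-unique u (suc r) = Unique.cartesianProductWith⁺ _∷_ ∷-injective u (vectors-unique u r)

removeAt-suc : ∀ {r} (x : A) (v : Vec A (suc r)) i → removeAt (x ∷ v) (fsuc i) ≡ x ∷ removeAt v i
removeAt-suc x (_ ∷ _) i = refl

lookup-removeAt : ∀ {r} (x : Vec A (suc r)) i p → lookup (removeAt x i) p ≡ lookup x (punchIn i p)
lookup-removeAt x i p = trans (cong (lookup (removeAt x i)) (sym (punchOut-punchIn i)))
                              (removeAt-punchOut x (punchInᵢ≢i i p ∘ sym))

∑-vectors-removeAt : ∀ (xs : List A) r (i : Fin (suc r)) (h : Vec A r → ℕ) →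
  ∑[ v ∈ vectors xs (suc r) ] h (removeAt v i) ≡ length xs * ∑ (vectors xs r) h
∑-vectors-removeAt xs r fzero h =
  trans (∑-cartesianProductWith _∷_ xs (vectors xs r) (λ v → h (removeAt v fzero)))
        (∑-const xs (∑ (vectors xs r) h))
∑-vectors-removeAt xs (suc r) (fsuc i) h = begin
  ∑[ v ∈ vectors xs (suc (suc r)) ] h (removeAt v (fsuc i))
    ≡⟨ ∑-cartesianProductWith _∷_ xs (vectors xs (suc r)) _ ⟩
  ∑[ x ∈ xs ] ∑[ v ∈ vectors xs (suc r) ] h (removeAt (x ∷ v) (fsuc i))
    ≡⟨ ∑-cong xs (λ x → ∑-cong (vectors xs (suc r)) (λ v → cong h (removeAt-suc x v i))) ⟩
  ∑[ x ∈ xs ] ∑[ v ∈ vectors xs (suc r) ] h (x ∷ removeAt v i)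
    ≡⟨ ∑-cong xs (λ x → ∑-vectors-removeAt xs r i (h ∘ (x ∷_))) ⟩
  ∑[ x ∈ xs ] (length xs * ∑[ w ∈ vectors xs r ] h (x ∷ w))
    ≡⟨ ∑-*ˡ xs (length xs) _ ⟩
  length xs * ∑[ x ∈ xs ] ∑[ w ∈ vectors xs r ] h (x ∷ w)
    ≡⟨ cong (length xs *_) (∑-cartesianProductWith _∷_ xs (vectors xs r) h) ⟨
  length xs * ∑ (vectors xs (suc r)) h
    ∎
  where open ≡-Reasoning

∑-vectors-1 : ∀ (xs : List A) r → ∑[ _ ∈ vectors xs r ] 1 ≡ length xs ^ r
∑-vectors-1 xs zero    = refl
∑-vectors-1 xs (suc r) =
  trans (∑-vectors-removeAt xs r fzero (const 1)) (cong (length xs *_) (∑-vectors-1 xs r))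

sublists : List A → List (List A)
sublists []       = [ [] ]
sublists (x ∷ xs) = map (x ∷_) (sublists xs) ++ sublists xs

filter∈sublists : ∀ {P : A → Set} (P? : ∀ x → Dec (P x)) xs → filter P? xs ∈ sublists xs
filter∈sublists P? []       = here refl
filter∈sublists P? (x ∷ xs) with does (P? x)
... | true  = ∈-++⁺ˡ (∈-map⁺ (x ∷_) (filter∈sublists P? xs))
... | false = ∈-++⁺ʳ (map (x ∷_) (sublists xs)) (filter∈sublists P? xs)

∈-─⁺ : ∀ {x y : A} {ys} (y∈ys : y ∈ ys) → x ∈ ys → x ≢ y → x ∈ ys ─ y∈ys
∈-─⁺ (here refl) (here refl) x≢y = ⊥-elim (x≢y refl)
∈-─⁺ (here refl) (there x∈)  x≢y = x∈
∈-─⁺ (there y∈)  (here refl) x≢y = here refl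
∈-─⁺ (there y∈)  (there x∈)  x≢y = there (∈-─⁺ y∈ x∈ x≢y)

length-mono-⊆ : ∀ {xs ys : List A} → Unique xs → xs ⊆ ys → length xs ≤ length ys
length-mono-⊆ {xs = []}          _                    _       = z≤n
length-mono-⊆ {xs = x ∷ xs} {ys} (x∉xs AllPairs.∷ u) x∷xs⊆ys = begin
  suc (length xs)          ≤⟨ s≤s (length-mono-⊆ u xs⊆ys─x) ⟩
  suc (length (ys ─ x∈ys)) ≡⟨ length-removeAt′ ys (Any.index x∈ys) ⟨
  length ys                ∎
  where
  open ≤-Reasoning
  x∈ys : x ∈ ys
  x∈ys = x∷xs⊆ys (here refl)
  xs⊆ys─x : xs ⊆ ys ─ x∈ys
  xs⊆ys─x z∈xs = ∈-─⁺ x∈ys (x∷xs⊆ys (there z∈xs)) (λ { refl → All.lookup x∉xs z∈xs refl })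

∈-img⁻ : ∀ {m n} (φ : Fin m → Fin n) (s : Subset m) {v} →
         v ∈ₛ img φ s → ∃ λ j → j ∈ₛ s × φ j ≡ v
∈-img⁻ {zero}  φ []      v∈ = ⊥-elim (∉⊥ v∈)
∈-img⁻ {suc m} φ (b ∷ s) v∈ with b | x∈p∪q⁻ _ (img (φ ∘ fsuc) s) v∈
... | true  | inj₁ v∈⁅φ0⁆ = fzero , Vec.here , sym (x∈⁅y⁆⇒x≡y _ v∈⁅φ0⁆)
... | false | inj₁ v∈⊥    = ⊥-elim (∉⊥ v∈⊥)
... | _     | inj₂ v∈rest =
  let j , j∈ , φj≡v = ∈-img⁻ (φ ∘ fsuc) s v∈rest in fsuc j , Vec.there j∈ , φj≡v

∈-img⁺ : ∀ {m n} (φ : Fin m → Fin n) (s : Subset m) {j} → j ∈ₛ s → φ j ∈ₛ img φ s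
∈-img⁺ φ (true ∷ s) Vec.here       = x∈p∪q⁺ (inj₁ (x∈⁅x⁆ _))
∈-img⁺ φ (b ∷ s)    (Vec.there j∈) =
  x∈p∪q⁺ {p = if b then ⁅ φ fzero ⁆ else Subset.⊥} (inj₂ (∈-img⁺ (φ ∘ fsuc) s j∈))

img-ext : ∀ {m m′ n} (f : Fin m → Fin n) (g : Fin m′ → Fin n) s s′ →
          (∀ {j} → j ∈ₛ s → ∃ λ j′ → j′ ∈ₛ s′ × g j′ ≡ f j) →
          (∀ {j′} → j′ ∈ₛ s′ → ∃ λ j → j ∈ₛ s × f j ≡ g j′) →
          img f s ≡ img g s′
img-ext f g s s′ f⊆g g⊆f = ⊆-antisym
  (λ v∈ → let j , j∈ , fj≡v = ∈-img⁻ f s v∈ ; j′ , j′∈ , gj′≡fj = f⊆g j∈ in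
          subst (_∈ₛ img g s′) (trans gj′≡fj fj≡v) (∈-img⁺ g s′ j′∈))
  (λ v∈ → let j′ , j′∈ , gj′≡v = ∈-img⁻ g s′ v∈ ; j , j∈ , fj≡gj′ = g⊆f j′∈ in
          subst (_∈ₛ img f s) (trans fj≡gj′ gj′≡v) (∈-img⁺ f s j∈))

img-cong : ∀ {m n} {f g : Fin m → Fin n} → (∀ j → f j ≡ g j) → ∀ s → img f s ≡ img g s
img-cong f≗g s = img-ext _ _ s s (λ {j} j∈ → j , j∈ , sym (f≗g j)) (λ {j} j∈ → j , j∈ , f≗g j)

∣⁅x⁆∪p∣ : ∀ {n} (x : Fin n) (p : Subset n) → x ∉ₛ p → ∣ ⁅ x ⁆ ∪ p ∣ ≡ suc ∣ p ∣
∣⁅x⁆∪p∣ fzero    (true ∷ p)  x∉p = ⊥-elim (x∉p Vec.here)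
∣⁅x⁆∪p∣ fzero    (false ∷ p) x∉p = cong (suc ∘ ∣_∣) (∪-identityˡ p)
∣⁅x⁆∪p∣ (fsuc x) (true ∷ p)  x∉p = cong suc (∣⁅x⁆∪p∣ x p (x∉p ∘ Vec.there))
∣⁅x⁆∪p∣ (fsuc x) (false ∷ p) x∉p = ∣⁅x⁆∪p∣ x p (x∉p ∘ Vec.there)

∣img⊤∣-injective : ∀ {k n} (σ : Fin k → Fin n) → Injective _≡_ _≡_ σ → ∣ img σ ⊤ ∣ ≡ k
∣img⊤∣-injective {zero}  {n} σ σ-inj = ∣⊥∣≡0 n
∣img⊤∣-injective {suc k}     σ σ-inj =
  trans (∣⁅x⁆∪p∣ (σ fzero) (img (σ ∘ fsuc) ⊤) σ0∉)
        (cong suc (∣img⊤∣-injective (σ ∘ fsuc) (Fin.suc-injective ∘ σ-inj)))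
  where
  σ0∉ : σ fzero ∉ₛ img (σ ∘ fsuc) ⊤
  σ0∉ σ0∈ with ∈-img⁻ (σ ∘ fsuc) ⊤ σ0∈
  ... | j , _ , σ[1+j]≡σ0 with σ-inj σ[1+j]≡σ0
  ... | ()

face : ∀ {k n} → (Fin (suc k) → Fin n) → Fin (suc k) → Subset n
face φ i = img φ (∁ ⁅ i ⁆)

∈∁⁅⁆⁺ : ∀ {n} {i j : Fin n} → j ≢ i → j ∈ₛ ∁ ⁅ i ⁆
∈∁⁅⁆⁺ = x∉p⇒x∈∁p ∘ x≢y⇒x∉⁅y⁆

∈∁⁅⁆⁻ : ∀ {n} {i j : Fin n} → j ∈ₛ ∁ ⁅ i ⁆ → j ≢ i
∈∁⁅⁆⁻ = x∉⁅y⁆⇒x≢y ∘ x∈∁p⇒x∉p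

∈-face : ∀ {k n} (φ : Fin (suc k) → Fin n) {i j} → j ≢ i → φ j ∈ₛ face φ i
∈-face φ j≢i = ∈-img⁺ φ _ (∈∁⁅⁆⁺ j≢i)

face-punchIn : ∀ {k n} (φ : Fin (suc k) → Fin n) i → face φ i ≡ img (φ ∘ punchIn i) ⊤
face-punchIn φ i = img-ext φ (φ ∘ punchIn i) (∁ ⁅ i ⁆) ⊤
  (λ j∈ → let i≢j = ∈∁⁅⁆⁻ j∈ ∘ sym in punchOut i≢j , ∈⊤ , cong φ (punchIn-punchOut i≢j))
  (λ {p} _ → punchIn i p , ∈∁⁅⁆⁺ (punchInᵢ≢i i p) , refl)

face-∘-permutation : ∀ {k n} (φ : Fin (suc k) → Fin n) (π : Permutation′ (suc k)) i →
                     face (φ ∘ (π ⟨$⟩ʳ_)) i ≡ face φ (π ⟨$⟩ʳ i)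
face-∘-permutation φ π i = img-ext _ φ (∁ ⁅ i ⁆) (∁ ⁅ π ⟨$⟩ʳ i ⁆)
  (λ {j} j∈ → π ⟨$⟩ʳ j , ∈∁⁅⁆⁺ (∈∁⁅⁆⁻ j∈ ∘ Injection.injective (↔⇒↣ π)) , refl)
  (λ {j′} j′∈ → π ⟨$⟩ˡ j′ , ∈∁⁅⁆⁺ (λ { refl → ∈∁⁅⁆⁻ j′∈ (sym (inverseʳ π)) }) ,
                cong φ (inverseʳ π))

IsCopy : ∀ k t {n} → KGraph k n → (Fin (suc k) → Fin n) → Set
IsCopy k t H φ = Injective _≡_ _≡_ φ × (∀ i → toℕ i < t → face φ i ∈ edges H)

IsCopy-cong : ∀ {k t n} (H : KGraph k n) {φ ψ : Fin (suc k) → Fin n} →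
              (∀ j → φ j ≡ ψ j) → IsCopy k t H φ → IsCopy k t H ψ
IsCopy-cong H φ≗ψ (φ-inj , faces) =
  (λ {x} {y} ψx≡ψy → φ-inj (trans (φ≗ψ x) (trans ψx≡ψy (sym (φ≗ψ y))))) ,
  (λ i i<t → subst (_∈ edges H) (img-cong φ≗ψ (∁ ⁅ i ⁆)) (faces i i<t))

injective? : ∀ {m n} (φ : Fin m → Fin n) → Dec (Injective _≡_ _≡_ φ)
injective? φ = map′ (λ inj {x} {y} → inj x y) (λ inj x y → inj)
                    (all? λ x → all? λ y → (φ x ≟ φ y) →-dec (x ≟ y))

_∈?_ : ∀ {n} (e : Subset n) (es : List (Subset n)) → Dec (e ∈ es)
_∈?_ {n} = DecMembership._∈?_ (≡-dec {n = n} Bool._≟_)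

isCopy? : ∀ k t {n} (H : KGraph k n) φ → Dec (IsCopy k t H φ)
isCopy? k t H φ = injective? φ ×-dec all? (λ i → (toℕ i <? t) →-dec (face φ i ∈? edges H))

containsH? : ∀ k t {n} (H : KGraph k n) → Dec (ContainsH k t H)
containsH? k t {n} H = map′
  (λ copy → let v , v-copy = Any.satisfied copy in lookup v , v-copy)
  (λ (φ , φ-copy) → lose (∈-vectors ∈-allFin (tabulate φ))
                         (IsCopy-cong H (sym ∘ lookup∘tabulate φ) φ-copy))
  (Any.any? (isCopy? k t H ∘ lookup) (vectors (allFin n) (suc k)))

ContainsH-mono : ∀ {k t n} {G H : KGraph k n} → edges G ⊆ edges H → ContainsH k t G → ContainsH k t H
ContainsH-mono G⊆H (φ , φ-inj , faces) = φ , φ-inj , λ i i<t → G⊆H (faces i i<t)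

allSubsets : ∀ n → List (Subset n)
allSubsets = vectors (true ∷ false ∷ [])

kSubsets : ∀ k n → List (Subset n)
kSubsets k n = filter (λ s → ∣ s ∣ ℕ.≟ k) (allSubsets n)

kSubsets-unique : ∀ k n → Unique (kSubsets k n)
kSubsets-unique k n =
  Unique.filter⁺ _ (vectors-unique (((λ ()) All.∷ All.[]) AllPairs.∷ All.[] AllPairs.∷ AllPairs.[]) n)

∈-kSubsets : ∀ {k n} {s : Subset n} → ∣ s ∣ ≡ k → s ∈ kSubsets k n
∈-kSubsets {s = s} =
  ∈-filter⁺ (λ s → ∣ s ∣ ℕ.≟ _) (∈-vectors (λ { true → here refl ; false → there (here refl) }) s)

fromEdges : ∀ {k n} → List (Subset n) → KGraph k n
fromEdges {k} {n} es = record
  { edges  = filter (_∈? es) (kSubsets k n)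
  ; unique = Unique.filter⁺ (_∈? es) (kSubsets-unique k n)
  ; sized  = Allₚ.filter⁺ (_∈? es) (Allₚ.all-filter (λ s → ∣ s ∣ ℕ.≟ k) (allSubsets n))
  }

∈-fromEdges⁻ : ∀ {k n} {es : List (Subset n)} {e} → e ∈ edges (fromEdges {k} es) → e ∈ es
∈-fromEdges⁻ {k} {n} {es} = proj₂ ∘ ∈-filter⁻ (_∈? es) {xs = kSubsets k n}

∈-fromEdges⁺ : ∀ {k n} {es : List (Subset n)} {e} →
               ∣ e ∣ ≡ k → e ∈ es → e ∈ edges (fromEdges {k} es)
∈-fromEdges⁺ {es = es} ∣e∣≡k = ∈-filter⁺ (_∈? es) (∈-kSubsets ∣e∣≡k)

emptyGraph : ∀ {k n} → KGraph k n
emptyGraph = record { edges = [] ; unique = AllPairs.[] ; sized = All.[] }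

emptyGraph-free : ∀ {k t n} → 1 ≤ t → HFree k t (emptyGraph {k} {n})
emptyGraph-free 1≤t (_ , _ , faces) with faces fzero 1≤t
... | ()

extremalGraph : ∀ k t n → 1 ≤ t →
  ∃ λ (G : KGraph k n) → HFree k t G ×
    (∀ (G′ : KGraph k n) → HFree k t G′ → nEdges G′ ≤ nEdges G)
extremalGraph k t n 1≤t = G , G-free , G-max
  where
  free? : (H : KGraph k n) → Dec (HFree k t H)
  free? H = ¬? (containsH? k t H)
  graphs : List (KGraph k n)
  graphs = map fromEdges (sublists (kSubsets k n))
  G : KGraph k n
  G = argmax nEdges emptyGraph (filter free? graphs)
  G-free : HFree k t G
  G-free = argmax-all nEdges (emptyGraph-free 1≤t) (Allₚ.all-filter free? graphs)
  G-max : ∀ G′ → HFree k t G′ → nEdges G′ ≤ nEdges G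
  G-max G′ G′-free = ≤-trans (length-mono-⊆ (unique G′) G′⊆F)
                             (All.lookup (f[xs]≤f[argmax] {f = nEdges} emptyGraph (filter free? graphs)) F∈)
    where
    es : List (Subset n)
    es = filter (_∈? edges G′) (kSubsets k n)
    F : KGraph k n
    F = fromEdges es
    F⊆G′ : edges F ⊆ edges G′
    F⊆G′ = proj₂ ∘ ∈-filter⁻ (_∈? edges G′) {xs = kSubsets k n} ∘ ∈-fromEdges⁻ {es = es}
    G′⊆F : edges G′ ⊆ edges F
    G′⊆F e∈ = let ∣e∣≡k = All.lookup (sized G′) e∈ in
              ∈-fromEdges⁺ {es = es} ∣e∣≡k (∈-filter⁺ (_∈? edges G′) (∈-kSubsets ∣e∣≡k) e∈)
    F∈ : F ∈ filter free? graphs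
    F∈ = ∈-filter⁺ free? (∈-map⁺ fromEdges (filter∈sublists (_∈? edges G′) (kSubsets k n)))
                   (G′-free ∘ ContainsH-mono {G = F} {G′} F⊆G′)

-- Reordering the vertices of a copy

ContainsH-permute : ∀ {k t n} (H : KGraph k n) {φ : Fin (suc k) → Fin n} → Injective _≡_ _≡_ φ →
                    (π : Permutation′ (suc k)) →
                    (∀ i → toℕ i < t → face φ (π ⟨$⟩ʳ i) ∈ edges H) → ContainsH k t H
ContainsH-permute H {φ} φ-inj π faces =
  φ ∘ (π ⟨$⟩ʳ_) , Injection.injective (↔⇒↣ π) ∘ φ-inj ,
  λ i i<t → subst (_∈ edges H) (sym (face-∘-permutation φ π i)) (faces i i<t)

module _ {n : ℕ} where

  below≢above : ∀ {t} {i T : Fin n} → toℕ i < t → t ≤ toℕ T → i ≢ T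
  below≢above i<t t≤T refl = <⇒≱ i<t t≤T

  transpose-matchˡ : ∀ (a T : Fin n) → transpose a T ⟨$⟩ʳ a ≡ T
  transpose-matchˡ a T rewrite dec-true (a ≟ a) refl = refl

  transpose-other : ∀ {a T i : Fin n} → i ≢ a → i ≢ T → transpose a T ⟨$⟩ʳ i ≡ i
  transpose-other {a} {T} {i} i≢a i≢T rewrite dec-false (i ≟ a) i≢a | dec-false (i ≟ T) i≢T = refl

  transpose-below : ∀ {t} {a T i : Fin n} → t ≤ toℕ T → toℕ i < t →
                    (i ≡ a × transpose a T ⟨$⟩ʳ i ≡ T) ⊎ (i ≢ a × transpose a T ⟨$⟩ʳ i ≡ i)
  transpose-below {a = a} {T} {i} t≤T i<t with a ≟ i
  ... | yes refl = inj₁ (refl , transpose-matchˡ a T)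
  ... | no  a≢i  = inj₂ (a≢i ∘ sym , transpose-other (a≢i ∘ sym) (below≢above i<t t≤T))

  transpose-fills : ∀ {t} {P : Fin n → Set} {a T : Fin n} → t ≤ toℕ T → P T →
                    (∀ i → toℕ i < t → i ≢ a → P i) →
                    ∀ i → toℕ i < t → P (transpose a T ⟨$⟩ʳ i)
  transpose-fills {P = P} t≤T PT P-except i i<t with transpose-below t≤T i<t
  ... | inj₁ (_   , τi≡T) = subst P (sym τi≡T) PT
  ... | inj₂ (i≢a , τi≡i) = subst P (sym τi≡i) (P-except i i<t i≢a)

  transpose²-fills : ∀ {t} {P : Fin n → Set} {a b T₀ T₁ : Fin n} →
                     toℕ a < t → t ≤ toℕ T₀ → t ≤ toℕ T₁ → T₀ ≢ T₁ → P T₀ → P T₁ →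
                     (∀ i → toℕ i < t → i ≢ a → i ≢ b → P i) →
                     ∀ i → toℕ i < t → P ((transpose b T₁ ∘ₚ transpose a T₀) ⟨$⟩ʳ i)
  transpose²-fills {P = P} {a} {b} {T₀} {T₁} a<t t≤T₀ t≤T₁ T₀≢T₁ PT₀ PT₁ P-except =
    transpose-fills {P = P ∘ (transpose a T₀ ⟨$⟩ʳ_)} t≤T₁ Pτ₀T₁ Pτ₀-except
    where
    Pτ₀T₁ : P (transpose a T₀ ⟨$⟩ʳ T₁)
    Pτ₀T₁ = subst P (sym (transpose-other (below≢above a<t t≤T₁ ∘ sym) (T₀≢T₁ ∘ sym))) PT₁
    Pτ₀-except : ∀ i → toℕ i < _ → i ≢ b → P (transpose a T₀ ⟨$⟩ʳ i)
    Pτ₀-except i i<t i≢b with transpose-below {a = a} t≤T₀ i<t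
    ... | inj₁ (_   , τi≡T₀) = subst P (sym τi≡T₀) PT₀
    ... | inj₂ (i≢a , τi≡i)  = subst P (sym τi≡i) (P-except i i<t i≢a i≢b)

  -- Each index below t where P fails is swapped with one of t, t + 1 where P holds.
  module _ {t} {P : Fin n → Set} (P? : ∀ i → Dec (P i)) (2+t≤n : 2 + t ≤ n)
    (no-three-failures : ∀ {a b c} → toℕ a < 2 + t → toℕ b < 2 + t → toℕ c < 2 + t →
                         a ≢ b → a ≢ c → b ≢ c → ¬ P a → ¬ P b → ¬ P c → ⊥) where

    private
      T₀ T₁ : Fin n
      T₀ = fromℕ< (≤-trans (n≤1+n _) 2+t≤n)
      T₁ = fromℕ< 2+t≤n
      t≤T₀ : t ≤ toℕ T₀
      t≤T₀ = ≤-reflexive (sym (toℕ-fromℕ< _))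
      t≤T₁ : t ≤ toℕ T₁
      t≤T₁ = ≤-trans (n≤1+n t) (≤-reflexive (sym (toℕ-fromℕ< _)))
      T₀<2+t : toℕ T₀ < 2 + t
      T₀<2+t = ≤-trans (≤-reflexive (cong suc (toℕ-fromℕ< _))) (n≤1+n _)
      T₁<2+t : toℕ T₁ < 2 + t
      T₁<2+t = ≤-reflexive (cong suc (toℕ-fromℕ< _))
      T₀≢T₁ : T₀ ≢ T₁
      T₀≢T₁ T₀≡T₁ =
        1+n≢n (trans (sym (toℕ-fromℕ< _)) (trans (cong toℕ (sym T₀≡T₁)) (toℕ-fromℕ< _)))
      <2+t : ∀ {i : Fin n} → toℕ i < t → toℕ i < 2 + t
      <2+t i<t = <-≤-trans i<t (m≤n+m t 2)

    permute-into : ∃ λ (π : Permutation′ n) → ∀ i → toℕ i < t → P (π ⟨$⟩ʳ i)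
    permute-into with any? (λ a → (toℕ a <? t) ×-dec ¬? (P? a))
    ... | no no-failure = Perm.id , λ i i<t → decidable-stable (P? i) (λ ¬Pi → no-failure (i , i<t , ¬Pi))
    ... | yes (a , a<t , ¬Pa) with any? (λ b → (toℕ b <? t) ×-dec ¬? (b ≟ a) ×-dec ¬? (P? b))
    ...   | yes (b , b<t , b≢a , ¬Pb) =
      transpose b T₁ ∘ₚ transpose a T₀ ,
      transpose²-fills a<t t≤T₀ t≤T₁ T₀≢T₁
        (P-except T₀ T₀<2+t (below≢above a<t t≤T₀ ∘ sym) (below≢above b<t t≤T₀ ∘ sym))
        (P-except T₁ T₁<2+t (below≢above a<t t≤T₁ ∘ sym) (below≢above b<t t≤T₁ ∘ sym))
        (λ i i<t → P-except i (<2+t i<t))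
      where
      P-except : ∀ i → toℕ i < 2 + t → i ≢ a → i ≢ b → P i
      P-except i i<2+t i≢a i≢b = decidable-stable (P? i)
        (no-three-failures (<2+t a<t) (<2+t b<t) i<2+t (b≢a ∘ sym) (i≢a ∘ sym) (i≢b ∘ sym) ¬Pa ¬Pb)
    ...   | no one-failure = let T , t≤T , PT = good-T in transpose a T , transpose-fills t≤T PT P-except
      where
      P-except : ∀ i → toℕ i < t → i ≢ a → P i
      P-except i i<t i≢a = decidable-stable (P? i) (λ ¬Pi → one-failure (i , i<t , i≢a , ¬Pi))
      good-T : ∃ λ T → t ≤ toℕ T × P T
      good-T with P? T₀
      ... | yes PT₀ = T₀ , t≤T₀ , PT₀
      ... | no ¬PT₀ = T₁ , t≤T₁ , decidable-stable (P? T₁)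
        (no-three-failures (<2+t a<t) T₀<2+t T₁<2+t
           (below≢above a<t t≤T₀) (below≢above a<t t≤T₁) T₀≢T₁ ¬Pa ¬PT₀)

avoid-two : ∀ {n} {Q : Fin n → Set} {a b c} → a ≢ b → a ≢ c → b ≢ c → Q a → Q b → Q c →
            ∀ x x′ → ∃ λ j → Q j × j ≢ x × j ≢ x′
avoid-two {a = a} {b} {c} a≢b a≢c b≢c Qa Qb Qc x x′ with a ≟ x | a ≟ x′ | b ≟ x | b ≟ x′
... | no a≢x   | no a≢x′  | _        | _        = a , Qa , a≢x , a≢x′
... | _        | _        | no b≢x   | no b≢x′  = b , Qb , b≢x , b≢x′
... | yes refl | _        | _        | yes refl = c , Qc , a≢c ∘ sym , b≢c ∘ sym
... | _        | yes refl | yes refl | _        = c , Qc , b≢c ∘ sym , a≢c ∘ sym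
... | yes refl | _        | yes refl | _        = ⊥-elim (a≢b refl)
... | _        | yes refl | _        | yes refl = ⊥-elim (a≢b refl)

-- Blocks, transversals and crosses

module Blocks {k n m : ℕ} (km≤n : suc k * m ≤ n) where

  vertex : Fin (suc k) → Fin m → Fin n
  vertex j a = inject≤ (combine j a) km≤n

  vertex-injective : ∀ {j j′ a a′} → vertex j a ≡ vertex j′ a′ → j ≡ j′ × a ≡ a′
  vertex-injective = combine-injective _ _ _ _ ∘ inject≤-injective _ _ _ _

  transversal : Vec (Fin m) (suc k) → Fin (suc k) → Fin n
  transversal x j = vertex j (lookup x j)

  transversal-injective : ∀ x → Injective _≡_ _≡_ (transversal x)
  transversal-injective x = proj₁ ∘ vertex-injective

  crossMap : Fin (suc k) → Vec (Fin m) k → Fin k → Fin n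
  crossMap i y p = vertex (punchIn i p) (lookup y p)

  crossMap-slot : ∀ i y y′ {p p′} → crossMap i y p ≡ crossMap i y′ p′ → p ≡ p′
  crossMap-slot i _ _ = punchIn-injective i _ _ ∘ proj₁ ∘ vertex-injective

  cross : Fin (suc k) → Vec (Fin m) k → Subset n
  cross i y = img (crossMap i y) ⊤

  IsCross : Fin (suc k) → Subset n → Set
  IsCross i e = ∃ λ y → e ≡ cross i y

  ∈-cross⁻ : ∀ {i y v} → v ∈ₛ cross i y → ∃ λ p → crossMap i y p ≡ v
  ∈-cross⁻ {i} {y} v∈ = let p , _ , crossp≡v = ∈-img⁻ (crossMap i y) ⊤ v∈ in p , crossp≡v

  ∣cross∣ : ∀ i y → ∣ cross i y ∣ ≡ k
  ∣cross∣ i y = ∣img⊤∣-injective (crossMap i y) (crossMap-slot i y y)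

  cross-injective : ∀ i {y y′} → cross i y ≡ cross i y′ → y ≡ y′
  cross-injective i {y} {y′} eq =
    trans (sym (tabulate∘lookup y)) (trans (tabulate-cong lookup-y≗y′) (tabulate∘lookup y′))
    where
    lookup-y≗y′ : ∀ p → lookup y p ≡ lookup y′ p
    lookup-y≗y′ p
      with ∈-cross⁻ {i} {y′} (subst (crossMap i y p ∈ₛ_) eq (∈-img⁺ (crossMap i y) ⊤ ∈⊤))
    ... | q , crossq≡crossp with crossMap-slot i y′ y crossq≡crossp
    ... | refl = sym (proj₂ (vertex-injective {punchIn i p} {punchIn i p} crossq≡crossp))

  face-transversal : ∀ x i → face (transversal x) i ≡ cross i (removeAt x i)
  face-transversal x i = trans (face-punchIn (transversal x) i)
    (img-cong (λ p → cong (vertex (punchIn i p)) (sym (lookup-removeAt x i p))) ⊤)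

  -- Any two vertices of the copy lie in one of the three crosses, and a cross meets every
  -- block other than i at most once, so the blocks of the k + 1 vertices are distinct.
  no-three-cross-faces : ∀ {i} (φ : Fin (suc k) → Fin n) → Injective _≡_ _≡_ φ →
    ∀ {a b c} → a ≢ b → a ≢ c → b ≢ c →
    IsCross i (face φ a) → IsCross i (face φ b) → IsCross i (face φ c) → ⊥
  no-three-cross-faces {i} φ φ-inj a≢b a≢c b≢c Ca Cb Cc =
    <⇒≱ (n<1+n k) (injective⇒≤ {f = slot} slot-injective)
    where
    common-cross : ∀ x x′ → ∃₂ λ j y → face φ j ≡ cross i y × j ≢ x × j ≢ x′
    common-cross x x′ =
      let j , (y , face≡cross) , j≢x , j≢x′ = avoid-two a≢b a≢c b≢c Ca Cb Cc x x′
      in j , y , face≡cross , j≢x , j≢x′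
    in-cross : ∀ {j} y {x} → face φ j ≡ cross i y → j ≢ x → ∃ λ p → crossMap i y p ≡ φ x
    in-cross y face≡cross j≢x =
      ∈-cross⁻ {i} {y} (subst (_ ∈ₛ_) face≡cross (∈-face φ (j≢x ∘ sym)))
    locate : ∀ x → ∃₂ λ y p → crossMap i y p ≡ φ x
    locate x = let _ , y , face≡cross , j≢x , _ = common-cross x x in y , in-cross y face≡cross j≢x
    slot : Fin (suc k) → Fin k
    slot x = proj₁ (proj₂ (locate x))
    slot-spec : ∀ {j} y {x} → face φ j ≡ cross i y → j ≢ x → crossMap i y (slot x) ≡ φ x
    slot-spec y {x} face≡cross j≢x =
      let p , crossp≡φx = in-cross y face≡cross j≢x
          y₀ , _ , crossp₀≡φx = locate x
      in subst (λ q → crossMap i y q ≡ φ x)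
               (crossMap-slot i y y₀ (trans crossp≡φx (sym crossp₀≡φx))) crossp≡φx
    slot-injective : Injective _≡_ _≡_ slot
    slot-injective {x} {x′} slotx≡slotx′ =
      let _ , y , face≡cross , j≢x , j≢x′ = common-cross x x′
      in φ-inj (trans (sym (slot-spec y face≡cross j≢x))
                      (trans (cong (crossMap i y) slotx≡slotx′) (slot-spec y face≡cross j≢x′)))

module Extension {k n m : ℕ} (km≤n : suc k * m ≤ n) (G : KGraph k n) where
  open Blocks {k} {n} {m} km≤n

  positions : List (Vec (Fin m) k)
  positions = vectors (allFin m) k

  absent? : ∀ e → Dec (¬ e ∈ edges G)
  absent? e = ¬? (e ∈? edges G)

  missing : Subset n → ℕ
  missing e = if does (absent? e) then 1 else 0

  missing≡0⇒∈ : ∀ e → missing e ≡ 0 → e ∈ edges G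
  missing≡0⇒∈ e with e ∈? edges G
  ... | yes e∈G = λ _ → e∈G
  ... | no  _   = λ ()

  deficit : Fin (suc k) → ℕ
  deficit i = ∑[ y ∈ positions ] missing (cross i y)

  newEdges : Fin (suc k) → List (Subset n)
  newEdges i = map (cross i) (filter (absent? ∘ cross i) positions)

  extend : Fin (suc k) → KGraph k n
  extend i = record
    { edges  = edges G ++ newEdges i
    ; unique = Unique.++⁺ (unique G)
                 (Unique.map⁺ (cross-injective i) (Unique.filter⁺ _ (vectors-unique (Unique.allFin⁺ m) k)))
                 old∉new
    ; sized  = Allₚ.++⁺ (sized G) (Allₚ.map⁺ (All.universal (∣cross∣ i) _))
    }
    where
    old∉new : ∀ {e} → e ∈ edges G × e ∈ newEdges i → ⊥
    old∉new (e∈G , e∈new) with ∈-map⁻ (cross i) e∈new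
    ... | y , y∈ , refl = proj₂ (∈-filter⁻ (absent? ∘ cross i) {xs = positions} y∈) e∈G

  nEdges-extend : ∀ i → nEdges (extend i) ≡ nEdges G + deficit i
  nEdges-extend i = begin
    length (edges G ++ newEdges i)
      ≡⟨ length-++ (edges G) ⟩
    nEdges G + length (newEdges i)
      ≡⟨ cong (nEdges G +_) (length-map (cross i) (filter (absent? ∘ cross i) positions)) ⟩
    nEdges G + length (filter (absent? ∘ cross i) positions)
      ≡⟨ cong (nEdges G +_) (length-filter≡∑ (absent? ∘ cross i) positions) ⟩
    nEdges G + deficit i
      ∎
    where open ≡-Reasoning

  module _ {t} (G-free : HFree k t G) where

    deficit-large : t ≤ suc k → .{{_ : NonZero m}} → ∃ λ i → m ^ k ≤ t * deficit i
    deficit-large t≤1+k = i₀ , *-cancelˡ-≤ m (begin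
      m * m ^ k
        ≡⟨ cong (_^ suc k) (length-allFin m) ⟨
      length (allFin m) ^ suc k
        ≡⟨ ∑-vectors-1 (allFin m) (suc k) ⟨
      ∑[ x ∈ transversals ] 1
        ≤⟨ ∑-mono-≤ transversals some-face-missing ⟩
      ∑[ x ∈ transversals ] ∑[ i ∈ small ] missing (face (transversal x) i)
        ≡⟨ ∑-comm transversals small _ ⟩
      ∑[ i ∈ small ] ∑[ x ∈ transversals ] missing (face (transversal x) i)
        ≡⟨ ∑-cong small (λ i → ∑-cong transversals (λ x → cong missing (face-transversal x i))) ⟩
      ∑[ i ∈ small ] ∑[ x ∈ transversals ] missing (cross i (removeAt x i))
        ≡⟨ ∑-cong small (λ i → ∑-vectors-removeAt (allFin m) k i (missing ∘ cross i)) ⟩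
      ∑[ i ∈ small ] (length (allFin m) * deficit i)
        ≡⟨ ∑-*ˡ small (length (allFin m)) deficit ⟩
      length (allFin m) * ∑ small deficit
        ≡⟨ cong (_* ∑ small deficit) (length-allFin m) ⟩
      m * ∑ small deficit
        ≤⟨ *-monoʳ-≤ m (∑≤length*bound (f[xs]≤f[argmax] {f = deficit} fzero small)) ⟩
      m * (length small * deficit i₀)
        ≡⟨ cong (λ l → m * (l * deficit i₀)) (trans (length-map _ (allFin t)) (length-allFin t)) ⟩
      m * (t * deficit i₀)
        ∎)
      where
      open ≤-Reasoning
      transversals : List (Vec (Fin m) (suc k))
      transversals = vectors (allFin m) (suc k)
      small : List (Fin (suc k))
      small = map (λ i → inject≤ i t≤1+k) (allFin t)
      i₀ : Fin (suc k)
      i₀ = argmax deficit fzero small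
      ∈small : ∀ {i} → toℕ i < t → i ∈ small
      ∈small {i} i<t =
        subst (_∈ small) (toℕ-injective (trans (toℕ-inject≤ _ t≤1+k) (toℕ-fromℕ< i<t)))
              (∈-map⁺ _ (∈-allFin (fromℕ< i<t)))
      some-face-missing : ∀ x → 1 ≤ ∑[ i ∈ small ] missing (face (transversal x) i)
      some-face-missing x = n≢0⇒n>0 λ ∑≡0 → G-free (transversal x , transversal-injective x ,
        λ i i<t → missing≡0⇒∈ _ (n≤0⇒n≡0 (subst (_ ≤_) ∑≡0
                    (∈⇒≤∑ (missing ∘ face (transversal x)) (∈small i<t)))))

    extend-free : 2 + t ≤ suc k → ∀ i → HFree k (t + 2) (extend i)
    extend-free 2+t≤1+k i (φ , φ-inj , faces) =
      let π , π-fills = permute-into (λ j → face φ j ∈? edges G) 2+t≤1+k no-three-new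
      in G-free (ContainsH-permute G φ-inj π π-fills)
      where
      new-is-cross : ∀ {j} → toℕ j < 2 + t → ¬ face φ j ∈ edges G → IsCross i (face φ j)
      new-is-cross {j} j<2+t face∉G with ∈-++⁻ (edges G) (faces j (subst (toℕ j <_) (+-comm 2 t) j<2+t))
      ... | inj₁ face∈G   = ⊥-elim (face∉G face∈G)
      ... | inj₂ face∈new = let y , _ , face≡cross = ∈-map⁻ (cross i) face∈new in y , face≡cross
      no-three-new : ∀ {a b c} → toℕ a < 2 + t → toℕ b < 2 + t → toℕ c < 2 + t →
                     a ≢ b → a ≢ c → b ≢ c →
                     ¬ face φ a ∈ edges G → ¬ face φ b ∈ edges G → ¬ face φ c ∈ edges G → ⊥
      no-three-new a<2+t b<2+t c<2+t a≢b a≢c b≢c a∉G b∉G c∉G =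
        no-three-cross-faces {i} φ φ-inj a≢b a≢c b≢c
          (new-is-cross a<2+t a∉G) (new-is-cross b<2+t b∉G) (new-is-cross c<2+t c∉G)

nCk≤n^k : ∀ n k → n C k ≤ n ^ k
nCk≤n^k n       zero    = ≤-refl
nCk≤n^k zero    (suc k) = z≤n
nCk≤n^k (suc n) (suc k) = begin
  suc n C suc k             ≡⟨ nCk+nC[k+1]≡[n+1]C[k+1] n k ⟨
  n C k + n C suc k         ≤⟨ +-mono-≤ (≤-trans (nCk≤n^k n k) n^k≤[1+n]^k)
                                        (≤-trans (nCk≤n^k n (suc k)) (*-monoʳ-≤ n n^k≤[1+n]^k)) ⟩
  suc n ^ k + n * suc n ^ k ∎
  where
  open ≤-Reasoning
  n^k≤[1+n]^k : n ^ k ≤ suc n ^ k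
  n^k≤[1+n]^k = ^-monoˡ-≤ k (n≤1+n n)

^-distribʳ-* : ∀ a b k → (a * b) ^ k ≡ a ^ k * b ^ k
^-distribʳ-* a b zero    = refl
^-distribʳ-* a b (suc k) = trans (cong (a * b *_) (^-distribʳ-* a b k)) (*-interchange a b (a ^ k) (b ^ k))

n≤[n/d]*2d : ∀ n d .{{_ : NonZero d}} → d ≤ n → n ≤ n / d * (2 * d)
n≤[n/d]*2d n d d≤n = begin
  n                     ≡⟨ m≡m%n+[m/n]*n n d ⟩
  n % d + n / d * d     ≤⟨ +-monoˡ-≤ (n / d * d) (<⇒≤ (m%n<n n d)) ⟩
  d + n / d * d         ≤⟨ +-monoˡ-≤ (n / d * d) (m≤n*m d (n / d) {{>-nonZero (m≥n⇒m/n>0 d≤n)}}) ⟩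
  n / d * d + n / d * d ≡⟨ *-distribˡ-+ (n / d) d d ⟨
  n / d * (d + d)       ≡⟨ cong (λ e → n / d * (d + e)) (+-identityʳ d) ⟨
  n / d * (2 * d)       ∎
  where open ≤-Reasoning

nCk≤c*[1+t*B^k] : ∀ {n k m t c} B → n ≤ m * B → m ^ k ≤ t * c → n C k ≤ c * suc (t * B ^ k)
nCk≤c*[1+t*B^k] {n} {k} {m} {t} {c} B n≤mB m^k≤tc = begin
  n C k               ≤⟨ nCk≤n^k n k ⟩
  n ^ k               ≤⟨ ^-monoˡ-≤ k n≤mB ⟩
  (m * B) ^ k         ≡⟨ ^-distribʳ-* m B k ⟩
  m ^ k * B ^ k       ≤⟨ *-monoˡ-≤ (B ^ k) m^k≤tc ⟩
  t * c * B ^ k       ≡⟨ cong (_* B ^ k) (*-comm t c) ⟩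
  c * t * B ^ k       ≡⟨ *-assoc c t (B ^ k) ⟩
  c * (t * B ^ k)     ≤⟨ *-monoʳ-≤ c (n≤1+n _) ⟩
  c * suc (t * B ^ k) ∎
  where open ≤-Reasoning

extremal-gap : ∀ {k t} → 1 ≤ t → 2 + t ≤ suc k → ∀ n → suc k ≤ n →
  ∃[ G ] (HFree k (t + 2) {n} G ×
    (∀ (G′ : KGraph k n) → HFree k t G′ →
       nEdges G′ * suc (t * (2 * suc k) ^ k) + n C k ≤ nEdges G * suc (t * (2 * suc k) ^ k)))
extremal-gap {k} {t} 1≤t 2+t≤1+k n 1+k≤n =
  extend i₀ , extend-free Gmax-free 2+t≤1+k i₀ , λ G′ G′-free → begin
    nEdges G′ * suc d + n C k
      ≤⟨ +-mono-≤ (*-monoˡ-≤ (suc d) (Gmax-max G′ G′-free))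
                  (nCk≤c*[1+t*B^k] {n} {k} {m} {t} (2 * suc k)
                     (n≤[n/d]*2d n (suc k) 1+k≤n) m^k≤t*deficit) ⟩
    nEdges Gmax * suc d + deficit i₀ * suc d
      ≡⟨ *-distribʳ-+ (suc d) (nEdges Gmax) (deficit i₀) ⟨
    (nEdges Gmax + deficit i₀) * suc d
      ≡⟨ cong (_* suc d) (nEdges-extend i₀) ⟨
    nEdges (extend i₀) * suc d
      ∎
  where
  open ≤-Reasoning
  d m : ℕ
  d = t * (2 * suc k) ^ k
  m = n / suc k
  instance
    m≢0 : NonZero m
    m≢0 = >-nonZero (m≥n⇒m/n>0 1+k≤n)
  km≤n : suc k * m ≤ n
  km≤n = subst (_≤ n) (*-comm m (suc k)) (m/n*n≤m n (suc k))
  Gmax : KGraph k n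
  Gmax = proj₁ (extremalGraph k t n 1≤t)
  Gmax-free : HFree k t Gmax
  Gmax-free = proj₁ (proj₂ (extremalGraph k t n 1≤t))
  Gmax-max : ∀ G′ → HFree k t G′ → nEdges G′ ≤ nEdges Gmax
  Gmax-max = proj₂ (proj₂ (extremalGraph k t n 1≤t))
  open Extension {k} {n} {m} km≤n Gmax
  i₀ : Fin (suc k)
  i₀ = proj₁ (deficit-large Gmax-free (≤-trans (m≤n+m t 2) 2+t≤1+k))
  m^k≤t*deficit : m ^ k ≤ t * deficit i₀
  m^k≤t*deficit = proj₂ (deficit-large Gmax-free (≤-trans (m≤n+m t 2) 2+t≤1+k))

corollary1p6 : ∀ (k t : ℕ) → 2 ≤ k → 1 ≤ t → t ≤ k ∸ 1 → πLess k t (t + 2)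
corollary1p6 k t 2≤k 1≤t t≤k∸1 = t * (2 * suc k) ^ k , suc k , extremal-gap 1≤t 2+t≤1+k
  where
  2+t≤1+k : 2 + t ≤ suc k
  2+t≤1+k = s≤s (≤-trans (s≤s t≤k∸1) (≤-reflexive (m+[n∸m]≡n (≤-trans (s≤s z≤n) 2≤k))))
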